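{- Let $G$ be a finite graph, $L$ a 4-assignment for $G$, and $\alpha,\beta$ $L$-colorings of $G$. Let $H$ be a subgraph of $G$, and let $v_1v_2v_3v_4$ be a 2-thread in $H$ (so $v_2,v_3$ have degree 2 in $H$). Let $H':=H-\{v_2,v_3\}$ and let $\sigma'$ be a 14-good $L$-recoloring sequence for $H'$ that transforms $\alpha_{\upharpoonright H'}$ to $\beta_{\upharpoonright H'}$. If $\sigma'$ recolors $v_4$ at most $s$ times, and $s\le 11$, then $H$ has a 14-good $L$-recoloring sequence that transforms $\alpha_{\upharpoonright H}$ to $\beta_{\upharpoonright H}$ and recolors $v_3$ at most $s+3$ times.
   Context: A 4-assignment $L$ assigns each vertex $v$ a set $L(v)$ of 4 colors; an $L$-coloring is a proper coloring $\varphi$ with $\varphi(v)\in L(v)$. For a subgraph $H$ and a coloring $\alpha$ of $G$, $\alpha_{\upharpoonright H}$ denotes the restriction of $\alpha$ to $V(H)$. An $L$-recoloring step changes the color of one vertex so that the result is again a proper $L$-coloring; an $L$-recoloring sequence is an initial $L$-coloring followed by $L$-recoloring steps, and it transforms $\alpha$ to $\beta$ if it starts at $\alpha$ and ends at $\beta$. It is 14-good if each vertex is recolored at most 14 times. A thread in a graph $H$ is a path all of whose internal vertices have degree 2 in $H$ (a cycle with exactly one vertex of degree at least 3 in $H$ and all other vertices of degree 2 also counts as a thread, that vertex serving as both endpoints); a $k$-thread is a thread with $k$ internal vertices. -}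

module Defs where

open import Data.Nat using (ℕ; zero; suc; _≤_; _+_)
open import Data.Nat.Properties using (_≟_)
open import Data.Fin using (Fin)
open import Data.List using (List; []; _∷_)
open import Data.Product using (Σ; ∃; _×_; _,_)
open import Data.Sum using (_⊎_)
open import Function.Definitions using (Injective)
open import Relation.Binary.PropositionalEquality using (_≡_)
open import Relation.Nullary using (¬_; yes; no)

record Graph (n : ℕ) : Set₁ where
  field
    Adj     : Fin n → Fin n → Set
    symAdj  : ∀ {u v} → Adj u v → Adj v u
    irrAdj  : ∀ {u} → ¬ Adj u u
open Graph public

record Subgraph {n : ℕ} (G : Graph n) : Set₁ where
  field
    V       : Fin n → Set
    E       : Fin n → Fin n → Set
    symE    : ∀ {u v} → E u v → E v u
    E⊆Adj   : ∀ {u v} → E u v → Adj G u v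
    E⇒V     : ∀ {u v} → E u v → V u × V v
open Subgraph public

deleteTwo : ∀ {n} {G : Graph n} → Subgraph G → Fin n → Fin n → Subgraph G
deleteTwo H a b = record
  { V     = λ u → V H u × ¬ u ≡ a × ¬ u ≡ b
  ; E     = λ u v → E H u v × (¬ u ≡ a × ¬ u ≡ b) × (¬ v ≡ a × ¬ v ≡ b)
  ; symE  = λ { (e , pu , pv) → symE H e , pv , pu }
  ; E⊆Adj = λ { (e , _ , _) → E⊆Adj H e }
  ; E⇒V   = λ { (e , (ua , ub) , (va , vb)) →
                let (hu , hv) = E⇒V H e in (hu , ua , ub) , (hv , va , vb) }
  }

record Assignment (n : ℕ) : Set where
  field
    list     : Fin n → Fin 4 → ℕ
    distinct : ∀ v → Injective _≡_ _≡_ (list v)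
open Assignment public

_∈L_at_ : ∀ {n} → ℕ → Assignment n → Fin n → Set
c ∈L L at v = ∃ λ i → list L v i ≡ c

-- Colorings are maps Fin n → ℕ; only values on V(H) are relevant for H.
-- φ is an L-coloring of the subgraph H.
IsLColoringOf : ∀ {n} {G : Graph n} → Assignment n → Subgraph G → (Fin n → ℕ) → Set
IsLColoringOf L H φ =
  (∀ v → V H v → φ v ∈L L at v) × (∀ u v → E H u v → ¬ φ u ≡ φ v)

IsLColoring : ∀ {n} → Assignment n → Graph n → (Fin n → ℕ) → Set
IsLColoring {n} L G φ =
  (∀ v → φ v ∈L L at v) × (∀ u v → Adj G u v → ¬ φ u ≡ φ v)

AgreeOn : ∀ {n} {G : Graph n} → Subgraph G → (Fin n → ℕ) → (Fin n → ℕ) → Set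
AgreeOn {n} H φ ψ = ∀ v → V H v → φ v ≡ ψ v

Step : ∀ {n} {G : Graph n} → Subgraph G → (Fin n → ℕ) → (Fin n → ℕ) → Set
Step {n} H φ ψ = Σ (Fin n) λ w →
  V H w × ¬ φ w ≡ ψ w × (∀ u → V H u → ¬ u ≡ w → φ u ≡ ψ u)

ValidSeq : ∀ {n} {G : Graph n} → Assignment n → Subgraph G →
           (Fin n → ℕ) → List (Fin n → ℕ) → Set
ValidSeq L H φ []       = IsLColoringOf L H φ
ValidSeq L H φ (ψ ∷ ψs) = IsLColoringOf L H φ × Step H φ ψ × ValidSeq L H ψ ψs

lastCol : ∀ {n} → (Fin n → ℕ) → List (Fin n → ℕ) → (Fin n → ℕ)
lastCol φ []       = φ
lastCol φ (ψ ∷ ψs) = lastCol ψ ψs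

recolorings : ∀ {n} → Fin n → (Fin n → ℕ) → List (Fin n → ℕ) → ℕ
recolorings v φ []       = 0
recolorings v φ (ψ ∷ ψs) with φ v ≟ ψ v
... | yes _ = recolorings v ψ ψs
... | no  _ = suc (recolorings v ψ ψs)

record RecoloringSeq {n} {G : Graph n} (L : Assignment n) (H : Subgraph G)
                     (α β : Fin n → ℕ) : Set where
  field
    start : Fin n → ℕ
    rest  : List (Fin n → ℕ)
    valid : ValidSeq L H start rest
    fromα : AgreeOn H start α
    toβ   : AgreeOn H (lastCol start rest) β
open RecoloringSeq public

timesRecolored : ∀ {n} {G : Graph n} {L : Assignment n} {H : Subgraph G} {α β} →
                 RecoloringSeq L H α β → Fin n → ℕ
timesRecolored σ v = recolorings v (start σ) (rest σ)

Good : ∀ {n} {G : Graph n} {L : Assignment n} {H : Subgraph G} {α β} →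
       ℕ → RecoloringSeq L H α β → Set
Good {n} {H = H} k σ = ∀ v → V H v → timesRecolored σ v ≤ k

HasNeighbours₂ : ∀ {n} {G : Graph n} → Subgraph G → Fin n → Fin n → Fin n → Set
HasNeighbours₂ {n} H v a b =
  E H v a × E H v b × ¬ a ≡ b × (∀ w → E H v w → w ≡ a ⊎ w ≡ b)

-- v1 v2 v3 v4 is a 2-thread in H: a path v1v2v3v4 in H whose internal vertices
-- v2, v3 have degree 2 in H.  If v1 = v4 the thread is a cycle, and then
-- v1 must have degree at least 3 in H.
TwoThread : ∀ {n} {G : Graph n} → Subgraph G → Fin n → Fin n → Fin n → Fin n → Set
TwoThread {n} H v1 v2 v3 v4 =
  HasNeighbours₂ H v2 v1 v3 ×
  HasNeighbours₂ H v3 v2 v4 ×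
  (v1 ≡ v4 → Σ (Fin n) λ w → E H v1 w × ¬ w ≡ v2 × ¬ w ≡ v3)

{-# OPTIONS --safe #-}
module Submission where

-- Follow σ' on H − {v2, v3}, keeping a colour x on v2 and y on v3 with x different from the
-- colour of v1 and from y, and y different from the colour of v4.  Just before v1 moves onto x,
-- recolour v2 to a colour avoiding the old and new colours of v1 and y; just before v4 moves
-- onto y, recolour v3 to a colour avoiding the old and new colours of v4 and x.  Four colours
-- leave room for both.  At the end one recolouring of v2 and two of v3 reach β.
-- If v1 moves R ≤ 14 times this recolours v2 up to R + 1 times, one too many, so the first
-- recolouring of v2 also avoids the colour v1 takes after its current move: that move is then
-- free for v2, at the price of perhaps one extra recolouring of v3 to make room.  If v4 moves
-- Q ≤ s times, v3 is recoloured at most Q + 3 times.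

open import Data.Fin using (Fin)
open import Data.Fin.Properties using (any?; injective⇒≤) renaming (_≟_ to _≟ᶠ_)
open import Data.List using (List; []; _∷_; lookup)
open import Data.List.Relation.Unary.Any using (here; there; index)
open import Data.List.Relation.Unary.Any.Properties using (lookup-index)
open import Data.Nat using (ℕ; suc; _≤_; _+_; _∸_; s≤s; z≤n)
open import Data.Nat.Properties
  using (_≟_; ≤-refl; ≤-trans; ≤-reflexive; n≤1+n; m≤n⇒m≤1+n; +-suc; +-monoˡ-≤; +-monoʳ-≤; ∸-monoˡ-≤)
open import Data.List.Membership.DecPropositional _≟_ using (_∈_; _∈?_)
open import Data.Product using (Σ; ∃-syntax; _×_; _,_; proj₁; proj₂)
open import Data.Sum using (_⊎_; inj₁; inj₂)
open import Data.Unit using (⊤; tt)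
open import Data.Vec.Functional using (updateAt)
open import Data.Vec.Functional.Properties using (updateAt-updates; updateAt-minimal)
open import Function using (_∘_; const)
open import Function.Definitions using (Injective)
open import Relation.Binary.PropositionalEquality using (_≡_; _≢_; refl; sym; trans; cong; subst)
open import Relation.Nullary using (yes; no; ¬?; contradiction)
open import Relation.Nullary.Decidable using (decidable-stable)

open import Defs

colour-avoiding-three : ∀ {n} (L : Assignment n) (v : Fin n) (a b c : ℕ) →
  ∃[ d ] d ∈L L at v × d ≢ a × d ≢ b × d ≢ c
colour-avoiding-three L v a b c with any? (λ i → ¬? (list L v i ∈? (a ∷ b ∷ c ∷ [])))
... | yes (i , free) =
  list L v i , (i , refl) , free ∘ here , free ∘ there ∘ here , free ∘ there ∘ there ∘ here
... | no none = contradiction (injective⇒≤ slot-injective) λ { (s≤s (s≤s (s≤s ()))) }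
  where
  listed : ∀ i → list L v i ∈ a ∷ b ∷ c ∷ []
  listed i = decidable-stable (list L v i ∈? _) (λ unlisted → none (i , unlisted))
  slot-injective : Injective _≡_ _≡_ (index ∘ listed)
  slot-injective {i} {j} same = distinct L v
    (trans (lookup-index (listed i)) (trans (cong (lookup _) same) (sym (lookup-index (listed j)))))

module _ {n : ℕ} (v : Fin n) where

  recolorings-∷-fixed : ∀ φ ψ ψs {b} → φ v ≡ ψ v →
    recolorings v ψ ψs ≤ b → recolorings v φ (ψ ∷ ψs) ≤ b
  recolorings-∷-fixed φ ψ ψs fixed le with φ v ≟ ψ v
  ... | yes _      = le
  ... | no changed = contradiction fixed changed

  recolorings-∷-moved : ∀ φ ψ ψs {b} → recolorings v ψ ψs ≤ b → recolorings v φ (ψ ∷ ψs) ≤ suc b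
  recolorings-∷-moved φ ψ ψs le with φ v ≟ ψ v
  ... | yes _ = m≤n⇒m≤1+n le
  ... | no _  = s≤s le

  recolorings-∷-mono : ∀ φ ψ ψs φ' ψ' ψs' → φ v ≡ φ' v → ψ v ≡ ψ' v →
    recolorings v ψ ψs ≤ recolorings v ψ' ψs' →
    recolorings v φ (ψ ∷ ψs) ≤ recolorings v φ' (ψ' ∷ ψs')
  recolorings-∷-mono φ ψ ψs φ' ψ' ψs' eq eq' le with φ v ≟ ψ v | φ' v ≟ ψ' v
  ... | yes _    | yes _      = le
  ... | yes _    | no _       = m≤n⇒m≤1+n le
  ... | no moved | yes stayed = contradiction (trans eq (trans stayed (sym eq'))) moved
  ... | no _     | no _       = s≤s le

  nextColour : ℕ → List (Fin n → ℕ) → ℕ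
  nextColour c []       = c
  nextColour c (ψ ∷ ψs) with c ≟ ψ v
  ... | yes _ = nextColour c ψs
  ... | no _  = ψ v

  nextColour-∷-≡ : ∀ c ψ ψs → c ≡ ψ v → nextColour c (ψ ∷ ψs) ≡ nextColour c ψs
  nextColour-∷-≡ c ψ ψs same with c ≟ ψ v
  ... | yes _      = refl
  ... | no changed = contradiction same changed

  nextColour-∷-≢ : ∀ c ψ ψs → c ≢ ψ v → nextColour c (ψ ∷ ψs) ≡ ψ v
  nextColour-∷-≢ c ψ ψs changed with c ≟ ψ v
  ... | yes same = contradiction same changed
  ... | no _     = refl

-- In mode initial the look-ahead recolouring of v2 is still available, in mode guarded it has
-- just been made (v2 also avoids the next colour of v1), and in mode steady it is spent.
data Mode : Set where
  initial guarded steady : Mode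

budget₂ : Mode → ℕ → ℕ
budget₂ initial R = 2 + (R ∸ 2)
budget₂ guarded R = 1 + (R ∸ 1)
budget₂ steady  R = 1 + R

slack₃ : Mode → ℕ
slack₃ initial = 3
slack₃ guarded = 2
slack₃ steady  = 2

budget₃ : Mode → ℕ → ℕ
budget₃ m Q = Q + slack₃ m

budget₂-≥1 : ∀ m → 1 ≤ budget₂ m 0
budget₂-≥1 initial = s≤s z≤n
budget₂-≥1 guarded = s≤s z≤n
budget₂-≥1 steady  = s≤s z≤n

budget₃-≥2 : ∀ m → 2 ≤ budget₃ m 0
budget₃-≥2 initial = s≤s (s≤s z≤n)
budget₃-≥2 guarded = s≤s (s≤s z≤n)
budget₃-≥2 steady  = s≤s (s≤s z≤n)

apart : ∀ {a b c d : ℕ} → a ≡ c → b ≡ d → c ≢ d → a ≢ b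
apart refl refl c≢d = c≢d

edge-apart : ∀ {n} {G : Graph n} (H : Subgraph G) {u w : Fin n} → E H u w → u ≢ w
edge-apart {G = G} H e refl = irrAdj G (E⊆Adj H e)

module Lifting {n} {G : Graph n} (L : Assignment n) (β : Fin n → ℕ) (β-colouring : IsLColoring L G β)
  (H : Subgraph G) (v1 v2 v3 v4 : Fin n)
  (e₂₁ : E H v2 v1) (e₂₃ : E H v2 v3) (e₃₄ : E H v3 v4) (v1≢v3 : v1 ≢ v3) (v2≢v4 : v2 ≢ v4)
  (N₂ : ∀ w → E H v2 w → w ≡ v1 ⊎ w ≡ v3) (N₃ : ∀ w → E H v3 w → w ≡ v2 ⊎ w ≡ v4) where

  Colouring : Set
  Colouring = Fin n → ℕ

  H' : Subgraph G
  H' = deleteTwo H v2 v3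

  v1≢v2 : v1 ≢ v2
  v1≢v2 = edge-apart H e₂₁ ∘ sym

  v2≢v3 : v2 ≢ v3
  v2≢v3 = edge-apart H e₂₃

  v4≢v2 : v4 ≢ v2
  v4≢v2 = v2≢v4 ∘ sym

  v4≢v3 : v4 ≢ v3
  v4≢v3 = edge-apart H e₃₄ ∘ sym

  v1∈H' : V H' v1
  v1∈H' = proj₂ (E⇒V H e₂₁) , v1≢v2 , v1≢v3

  v4∈H' : V H' v4
  v4∈H' = proj₂ (E⇒V H e₃₄) , v4≢v2 , v4≢v3

  data Position : Fin n → Set where
    at₂ : Position v2
    at₃ : Position v3
    off : ∀ {u} → u ≢ v2 → u ≢ v3 → Position u

  position : ∀ u → Position u
  position u with u ≟ᶠ v2 | u ≟ᶠ v3
  ... | yes refl | _        = at₂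
  ... | no _     | yes refl = at₃
  ... | no u≢v2  | no u≢v3  = off u≢v2 u≢v3

  graft : Colouring → ℕ → ℕ → Colouring
  graft φ x y = updateAt (updateAt φ v2 (const x)) v3 (const y)

  private variable
    φ ψ γ : Colouring
    ψs    : List Colouring
    x x' y y' b₂ b₃ b₂' b₃' : ℕ

  graft-v2 : graft φ x y v2 ≡ x
  graft-v2 {φ} = trans (updateAt-minimal v2 v3 _ v2≢v3) (updateAt-updates v2 φ)

  graft-v3 : graft φ x y v3 ≡ y
  graft-v3 = updateAt-updates v3 _

  graft-off : ∀ {u} → u ≢ v2 → u ≢ v3 → graft φ x y u ≡ φ u
  graft-off {φ} {u = u} u≢v2 u≢v3 =
    trans (updateAt-minimal u v3 _ u≢v3) (updateAt-minimal u v2 φ u≢v2)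

  graft-cong : ∀ u → (u ≡ v2 → x ≡ x') → (u ≡ v3 → y ≡ y') → (u ≢ v2 → u ≢ v3 → φ u ≡ ψ u) →
    graft φ x y u ≡ graft ψ x' y' u
  graft-cong u x≡x' y≡y' φ≡ψ with position u
  ... | at₂           = trans graft-v2 (trans (x≡x' refl) (sym graft-v2))
  ... | at₃           = trans graft-v3 (trans (y≡y' refl) (sym graft-v3))
  ... | off u≢v2 u≢v3 =
    trans (graft-off u≢v2 u≢v3) (trans (φ≡ψ u≢v2 u≢v3) (sym (graft-off u≢v2 u≢v3)))

  graft-agrees : AgreeOn H' φ γ → AgreeOn H (graft φ (γ v2) (γ v3)) γ
  graft-agrees φ≈γ u u∈H with position u
  ... | at₂           = graft-v2
  ... | at₃           = graft-v3
  ... | off u≢v2 u≢v3 = trans (graft-off u≢v2 u≢v3) (φ≈γ u (u∈H , u≢v2 , u≢v3))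

  record Fits (φ : Colouring) (x y : ℕ) : Set where
    constructor fits
    field
      x∈L  : x ∈L L at v2
      y∈L  : y ∈L L at v3
      x≢φ₁ : x ≢ φ v1
      x≢y  : x ≢ y
      y≢φ₄ : y ≢ φ v4

  colouring-fits : IsLColoring L G γ → AgreeOn H' φ γ → Fits φ (γ v2) (γ v3)
  colouring-fits (γ∈L , γ-proper) φ≈γ = fits (γ∈L v2) (γ∈L v3)
    (λ q → γ-proper v2 v1 (E⊆Adj H e₂₁) (trans q (φ≈γ v1 v1∈H')))
    (γ-proper v2 v3 (E⊆Adj H e₂₃))
    (λ q → γ-proper v3 v4 (E⊆Adj H e₃₄) (trans q (φ≈γ v4 v4∈H')))

  graft-isLColoring : IsLColoringOf L H' φ → Fits φ x y → IsLColoringOf L H (graft φ x y)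
  graft-isLColoring {φ} {x} {y} (φ∈L , φ-proper) (fits x∈L y∈L x≢φ₁ x≢y y≢φ₄) = in-lists , proper
    where
    in-lists : ∀ u → V H u → graft φ x y u ∈L L at u
    in-lists u u∈H with position u
    ... | at₂           = subst (_∈L L at v2) (sym graft-v2) x∈L
    ... | at₃           = subst (_∈L L at v3) (sym graft-v3) y∈L
    ... | off u≢v2 u≢v3 = subst (_∈L L at u) (sym (graft-off u≢v2 u≢v3)) (φ∈L u (u∈H , u≢v2 , u≢v3))

    graft-v1 : graft φ x y v1 ≡ φ v1
    graft-v1 = graft-off v1≢v2 v1≢v3

    graft-v4 : graft φ x y v4 ≡ φ v4
    graft-v4 = graft-off v4≢v2 v4≢v3

    proper : ∀ u w → E H u w → graft φ x y u ≢ graft φ x y w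
    proper u w e with position u
    proper _ w e | at₂ with N₂ w e
    ... | inj₁ refl = apart graft-v2 graft-v1 x≢φ₁
    ... | inj₂ refl = apart graft-v2 graft-v3 x≢y
    proper _ w e | at₃ with N₃ w e
    ... | inj₁ refl = apart graft-v3 graft-v2 (x≢y ∘ sym)
    ... | inj₂ refl = apart graft-v3 graft-v4 y≢φ₄
    proper u w e | off u≢v2 u≢v3 with position w
    proper u _ e | off u≢v2 u≢v3 | at₂ with N₂ u (symE H e)
    ... | inj₁ refl = apart graft-v1 graft-v2 (x≢φ₁ ∘ sym)
    ... | inj₂ refl = contradiction refl u≢v3
    proper u _ e | off u≢v2 u≢v3 | at₃ with N₃ u (symE H e)
    ... | inj₁ refl = contradiction refl u≢v2
    ... | inj₂ refl = apart graft-v4 graft-v3 (y≢φ₄ ∘ sym)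
    proper u w e | off u≢v2 u≢v3 | off w≢v2 w≢v3 =
      apart (graft-off u≢v2 u≢v3) (graft-off w≢v2 w≢v3)
        (φ-proper u w (e , (u≢v2 , u≢v3) , (w≢v2 , w≢v3)))

  record Lifted (φ : Colouring) (ψs : List Colouring) (x y b₂ b₃ : ℕ) : Set where
    constructor lifted
    field
      steps       : List Colouring
      steps-valid : ValidSeq L H (graft φ x y) steps
      steps-end   : AgreeOn H (lastCol (graft φ x y) steps) β
      others-≤    : ∀ u → u ≢ v2 → u ≢ v3 →
                    recolorings u (graft φ x y) steps ≤ recolorings u φ ψs
      v2-≤        : recolorings v2 (graft φ x y) steps ≤ b₂
      v3-≤        : recolorings v3 (graft φ x y) steps ≤ b₃

  weaken : b₂ ≤ b₂' → b₃ ≤ b₃' → Lifted φ ψs x y b₂ b₃ → Lifted φ ψs x y b₂' b₃'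
  weaken b₂≤ b₃≤ (lifted cs valid end others v2≤ v3≤) =
    lifted cs valid end others (≤-trans v2≤ b₂≤) (≤-trans v3≤ b₃≤)

  recolour₂ : IsLColoringOf L H' φ → Fits φ x y → x ≢ x' →
    Lifted φ ψs x' y b₂ b₃ → Lifted φ ψs x y (suc b₂) b₃
  recolour₂ {φ = φ} {x = x} {y = y} {x' = x'} cφ fit x≢x' (lifted cs valid end others v2≤ v3≤) =
    lifted (new ∷ cs) (graft-isLColoring cφ fit , step , valid) end
      (λ u u≢v2 u≢v3 → recolorings-∷-fixed u old new cs (fixed u u≢v2) (others u u≢v2 u≢v3))
      (recolorings-∷-moved v2 old new cs v2≤)
      (recolorings-∷-fixed v3 old new cs (fixed v3 (v2≢v3 ∘ sym)) v3≤)
    where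
    old new : Colouring
    old = graft φ x y
    new = graft φ x' y
    fixed : ∀ u → u ≢ v2 → old u ≡ new u
    fixed u u≢v2 = graft-cong u (λ u≡v2 → contradiction u≡v2 u≢v2) (const refl) (λ _ _ → refl)
    step : Step H old new
    step = v2 , proj₁ (E⇒V H e₂₁) , apart graft-v2 graft-v2 x≢x' , λ u _ → fixed u

  recolour₃ : IsLColoringOf L H' φ → Fits φ x y → y ≢ y' →
    Lifted φ ψs x y' b₂ b₃ → Lifted φ ψs x y b₂ (suc b₃)
  recolour₃ {φ = φ} {x = x} {y = y} {y' = y'} cφ fit y≢y' (lifted cs valid end others v2≤ v3≤) =
    lifted (new ∷ cs) (graft-isLColoring cφ fit , step , valid) end
      (λ u u≢v2 u≢v3 → recolorings-∷-fixed u old new cs (fixed u u≢v3) (others u u≢v2 u≢v3))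
      (recolorings-∷-fixed v2 old new cs (fixed v2 v2≢v3) v2≤)
      (recolorings-∷-moved v3 old new cs v3≤)
    where
    old new : Colouring
    old = graft φ x y
    new = graft φ x y'
    fixed : ∀ u → u ≢ v3 → old u ≡ new u
    fixed u u≢v3 = graft-cong u (const refl) (λ u≡v3 → contradiction u≡v3 u≢v3) (λ _ _ → refl)
    step : Step H old new
    step = v3 , proj₁ (E⇒V H e₃₄) , apart graft-v3 graft-v3 y≢y' , λ u _ → fixed u

  follow : IsLColoringOf L H' φ → Fits φ x y → Step H' φ ψ →
    Lifted ψ ψs x y b₂ b₃ → Lifted φ (ψ ∷ ψs) x y b₂ b₃
  follow {φ = φ} {x = x} {y = y} {ψ = ψ} {ψs = ψs} cφ fit (w , (w∈H , w≢v2 , w≢v3) , moved , fixed)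
    (lifted cs valid end others v2≤ v3≤) =
    lifted (new ∷ cs) (graft-isLColoring cφ fit , step , valid) end
      (λ u u≢v2 u≢v3 → recolorings-∷-mono u old new cs φ ψ ψs
        (graft-off u≢v2 u≢v3) (graft-off u≢v2 u≢v3) (others u u≢v2 u≢v3))
      (recolorings-∷-fixed v2 old new cs (trans graft-v2 (sym graft-v2)) v2≤)
      (recolorings-∷-fixed v3 old new cs (trans graft-v3 (sym graft-v3)) v3≤)
    where
    old new : Colouring
    old = graft φ x y
    new = graft ψ x y
    step : Step H old new
    step = w , w∈H , apart (graft-off w≢v2 w≢v3) (graft-off w≢v2 w≢v3) moved ,
      λ u u∈H u≢w → graft-cong u (const refl) (const refl)
        (λ u≢v2 u≢v3 → fixed u (u∈H , u≢v2 , u≢v3) u≢w)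

  arrive : IsLColoringOf L H' φ → AgreeOn H' φ β → Lifted φ [] (β v2) (β v3) 0 0
  arrive cφ φ≈β = lifted [] (graft-isLColoring cφ (colouring-fits β-colouring φ≈β))
    (graft-agrees φ≈β) (λ _ _ _ → z≤n) z≤n z≤n

  settle₃ : IsLColoringOf L H' φ → AgreeOn H' φ β → Fits φ (β v2) y → Lifted φ [] (β v2) y 0 1
  settle₃ {y = y} cφ φ≈β fit with y ≟ β v3
  ... | yes refl = weaken z≤n z≤n (arrive cφ φ≈β)
  ... | no y≢β₃  = recolour₃ cφ fit y≢β₃ (arrive cφ φ≈β)

  settle : IsLColoringOf L H' φ → AgreeOn H' φ β → Fits φ x y → Lifted φ [] x y 1 2
  settle {φ = φ} {x = x} {y = y} cφ φ≈β fit@(fits x∈L y∈L x≢φ₁ x≢y y≢φ₄)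
    with colouring-fits β-colouring φ≈β | β v2 ≟ y
  ... | fits β₂∈L _ β₂≢φ₁ _ _ | no β₂≢y with x ≟ β v2
  ... | yes refl = weaken z≤n (s≤s z≤n) (settle₃ cφ φ≈β fit)
  ... | no x≢β₂  = weaken ≤-refl (s≤s z≤n)
    (recolour₂ cφ fit x≢β₂ (settle₃ cφ φ≈β (fits β₂∈L y∈L β₂≢φ₁ β₂≢y y≢φ₄)))
  settle {φ = φ} {x = x} cφ φ≈β fit@(fits x∈L _ x≢φ₁ x≢y _) | fits β₂∈L _ β₂≢φ₁ _ _ | yes refl
    with colour-avoiding-three L v3 (φ v4) x (β v2)
  ... | y' , y'∈L , y'≢φ₄ , y'≢x , y'≢β₂ =
    recolour₃ cφ fit (y'≢β₂ ∘ sym)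
      (recolour₂ cφ (fits x∈L y'∈L x≢φ₁ (y'≢x ∘ sym) y'≢φ₄) x≢y
        (settle₃ cφ φ≈β (fits β₂∈L y'∈L β₂≢φ₁ (y'≢β₂ ∘ sym) y'≢φ₄)))

  Guard : Mode → ℕ → ℕ → List Colouring → Set
  Guard guarded x c ψs = x ≢ nextColour v1 c ψs
  Guard initial _ _ _  = ⊤
  Guard steady  _ _ _  = ⊤

  guard-stays : ∀ m → φ v1 ≡ ψ v1 → Guard m x (φ v1) (ψ ∷ ψs) → Guard m x (ψ v1) ψs
  guard-stays initial _ _ = tt
  guard-stays {φ = φ} {ψ = ψ} {x = x} {ψs = ψs} guarded stays guard =
    subst (λ c → x ≢ nextColour v1 c ψs) stays
      (λ q → guard (trans q (sym (nextColour-∷-≡ v1 (φ v1) ψ ψs stays))))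
  guard-stays steady  _ _ = tt

  mutual
    lift : ∀ m φ ψs → ValidSeq L H' φ ψs → AgreeOn H' (lastCol φ ψs) β →
      Fits φ x y → Guard m x (φ v1) ψs →
      Lifted φ ψs x y (budget₂ m (recolorings v1 φ ψs)) (budget₃ m (recolorings v4 φ ψs))
    lift m φ [] cφ end fit _ = weaken (budget₂-≥1 m) (budget₃-≥2 m) (settle cφ end fit)
    -- Splitting on the very test recolorings uses makes the count for v1 in the goal reduce.
    lift m φ (ψ ∷ ψs) valid end fit guard with φ v1 ≟ ψ v1
    ... | yes stays = lift-step m φ ψ ψs valid end fit
      (subst (_ ≢_) stays (Fits.x≢φ₁ fit)) (guard-stays {φ = φ} {ψ = ψ} m stays guard)
    lift {x = x} guarded φ (ψ ∷ ψs) valid end fit guard | no moves =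
      lift-step steady φ ψ ψs valid end fit
        (subst (x ≢_) (nextColour-∷-≢ v1 (φ v1) ψ ψs moves) guard) tt
    lift {x = x} initial φ (ψ ∷ ψs) valid end fit _ | no moves with ψ v1 ≟ x
    ... | no ψ₁≢x = weaken (s≤s (s≤s (∸-monoˡ-≤ 2 (n≤1+n (recolorings v1 ψ ψs))))) ≤-refl
      (lift-step initial φ ψ ψs valid end fit (ψ₁≢x ∘ sym) tt)
    ... | yes refl = look-ahead φ ψ ψs valid end fit
    lift {x = x} steady φ (ψ ∷ ψs) valid@(cφ , _) end fit _ | no moves with ψ v1 ≟ x
    ... | no ψ₁≢x = weaken (n≤1+n _) ≤-refl (lift-step steady φ ψ ψs valid end fit (ψ₁≢x ∘ sym) tt)
    ... | yes refl with fit | colour-avoiding-three L v2 (φ v1) (ψ v1) _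
    ... | fits _ y∈L _ _ y≢φ₄ | x' , x'∈L , x'≢φ₁ , x'≢ψ₁ , x'≢y =
      recolour₂ cφ fit (x'≢ψ₁ ∘ sym)
        (lift-step steady φ ψ ψs valid end (fits x'∈L y∈L x'≢φ₁ x'≢y y≢φ₄) x'≢ψ₁ tt)

    -- v1 is about to move onto x.  The new colour d of v2 also avoids the colour after that,
    -- so the following move of v1 is free; if d is the colour of v3, v3 first makes room.
    look-ahead : ∀ φ ψ ψs → ValidSeq L H' φ (ψ ∷ ψs) → AgreeOn H' (lastCol ψ ψs) β →
      Fits φ (ψ v1) y →
      Lifted φ (ψ ∷ ψs) (ψ v1) y (budget₂ initial (suc (recolorings v1 ψ ψs)))
        (budget₃ initial (recolorings v4 φ (ψ ∷ ψs)))
    look-ahead φ ψ ψs valid@(cφ , _) end fit@(fits x∈L y∈L x≢φ₁ _ y≢φ₄)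
      with colour-avoiding-three L v2 (φ v1) (ψ v1) (nextColour v1 (ψ v1) ψs)
    ... | d , d∈L , d≢φ₁ , d≢ψ₁ , d≢next with d ≟ _
    ... | no d≢y = weaken ≤-refl (+-monoʳ-≤ _ (n≤1+n 2)) (recolour₂ cφ fit (d≢ψ₁ ∘ sym)
      (lift-step guarded φ ψ ψs valid end (fits d∈L y∈L d≢φ₁ d≢y y≢φ₄) d≢ψ₁ d≢next))
    ... | yes refl with colour-avoiding-three L v3 (φ v4) (ψ v1) d
    ... | y' , y'∈L , y'≢φ₄ , y'≢x , y'≢d = weaken ≤-refl (≤-reflexive (sym (+-suc _ 2)))
      (recolour₃ cφ fit (y'≢d ∘ sym)
        (recolour₂ cφ (fits x∈L y'∈L x≢φ₁ (y'≢x ∘ sym) y'≢φ₄) (d≢ψ₁ ∘ sym)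
          (lift-step guarded φ ψ ψs valid end (fits d∈L y'∈L d≢φ₁ (y'≢d ∘ sym) y'≢φ₄) d≢ψ₁ d≢next)))

    lift-step : ∀ m φ ψ ψs → ValidSeq L H' φ (ψ ∷ ψs) → AgreeOn H' (lastCol ψ ψs) β →
      Fits φ x y → x ≢ ψ v1 → Guard m x (ψ v1) ψs →
      Lifted φ (ψ ∷ ψs) x y (budget₂ m (recolorings v1 ψ ψs)) (budget₃ m (recolorings v4 φ (ψ ∷ ψs)))
    lift-step m φ ψ ψs (cφ , step , valid) end fit x≢ψ₁ guard with fit | φ v4 ≟ ψ v4
    ... | fits x∈L y∈L _ x≢y y≢φ₄ | yes stays =
      follow cφ fit step
        (lift m ψ ψs valid end (fits x∈L y∈L x≢ψ₁ x≢y (subst (_ ≢_) stays y≢φ₄)) guard)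
    ... | fits x∈L y∈L x≢φ₁ x≢y _ | no moves with ψ v4 ≟ _
    ... | no ψ₄≢y = weaken ≤-refl (n≤1+n _)
      (follow cφ fit step (lift m ψ ψs valid end (fits x∈L y∈L x≢ψ₁ x≢y (ψ₄≢y ∘ sym)) guard))
    ... | yes refl with colour-avoiding-three L v3 (φ v4) (ψ v4) _
    ... | y' , y'∈L , y'≢φ₄ , y'≢ψ₄ , y'≢x =
      recolour₃ cφ fit (y'≢ψ₄ ∘ sym)
        (follow cφ (fits x∈L y'∈L x≢φ₁ (y'≢x ∘ sym) y'≢φ₄) step
          (lift m ψ ψs valid end (fits x∈L y'∈L x≢ψ₁ (y'≢x ∘ sym) y'≢ψ₄) guard))

lemma6 : ∀ {n} (G : Graph n) (L : Assignment n) (α β : Fin n → ℕ) →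
    IsLColoring L G α → IsLColoring L G β →
    (H : Subgraph G) (v1 v2 v3 v4 : Fin n) → TwoThread H v1 v2 v3 v4 →
    (σ' : RecoloringSeq L (deleteTwo H v2 v3) α β) → Good 14 σ' →
    (s : ℕ) → timesRecolored σ' v4 ≤ s → s ≤ 11 →
    Σ (RecoloringSeq L H α β) λ σ → Good 14 σ × timesRecolored σ v3 ≤ s + 3
lemma6 G L α β α-colouring β-colouring H v1 v2 v3 v4
  ((e₂₁ , e₂₃ , v1≢v3 , N₂) , (_ , e₃₄ , v2≢v4 , N₃) , _) σ' σ'-good s Q≤s s≤11 =
  σ , σ-good , ≤-trans (v3-≤ lifting) (+-monoˡ-≤ 3 Q≤s)
  where
  open Lifting L β β-colouring H v1 v2 v3 v4 e₂₁ e₂₃ e₃₄ v1≢v3 v2≢v4 N₂ N₃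
  open Lifted

  lifting : Lifted (start σ') (rest σ') (α v2) (α v3)
    (budget₂ initial (timesRecolored σ' v1)) (budget₃ initial (timesRecolored σ' v4))
  lifting = lift initial (start σ') (rest σ') (valid σ') (toβ σ')
    (colouring-fits α-colouring (fromα σ')) tt

  σ : RecoloringSeq L H α β
  σ = record
    { start = graft (start σ') (α v2) (α v3) ; rest = steps lifting ; valid = steps-valid lifting
    ; fromα = graft-agrees (fromα σ') ; toβ = steps-end lifting }

  σ-good : Good 14 σ
  σ-good u u∈H with position u
  ... | at₂           = ≤-trans (v2-≤ lifting) (s≤s (s≤s (∸-monoˡ-≤ 2 (σ'-good v1 v1∈H'))))
  ... | at₃           = ≤-trans (v3-≤ lifting) (+-monoˡ-≤ 3 (≤-trans Q≤s s≤11))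
  ... | off u≢v2 u≢v3 = ≤-trans (others-≤ lifting u u≢v2 u≢v3) (σ'-good u (u∈H , u≢v2 , u≢v3))
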